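{- Let $\mathrm{sort}$ be a sort function satisfying the characteristic property. Let $T$ be a type, $\leq_1$ and $\leq_2$ relations on $T$ with $\leq_1$ total and $\leq_2$ transitive, and $xs : \mathrm{list}\,T$. If $xs$ is sorted w.r.t. $\leq_2$, then $\mathrm{sort}_{\leq_1}\,xs$ is sorted w.r.t. the lexicographic relation $x \leq_{\mathrm{lex}} y :\Leftrightarrow x \leq_1 y \wedge (y \not\leq_1 x \vee x \leq_2 y)$.
   Context: A relation $R$ is total if $x \mathrel{R} y$ or $y \mathrel{R} x$ for all $x,y$, transitive if $x\mathrel{R}y$ and $y\mathrel{R}z$ imply $x\mathrel{R}z$. A list $[x_0,\dots,x_n]$ is sorted w.r.t. $R$ if $x_{i-1} \mathrel{R} x_i$ for all $1 \leq i \leq n$. Lists: $[]$ is the empty list, $x :: s$ is cons, $[x]$ is the singleton list, $\mathbin{+\!\!+}$ is concatenation. A "relation" $\leq$ on a type $T$ is a function $T \to T \to \mathrm{bool}$. The merge of two lists w.r.t. $\leq$ is defined by $[] \mathbin{\land\hspace{ -.45em}\land}_\leq ys = ys$, $xs \mathbin{\land\hspace{ -.45em}\land}_\leq [] = xs$, and $(x :: xs) \mathbin{\land\hspace{ -.45em}\land}_\leq (y :: ys) = x :: (xs \mathbin{\land\hspace{ -.45em}\land}_\leq (y :: ys))$ if $x \leq y$, and $= y :: ((x :: xs) \mathbin{\land\hspace{ -.45em}\land}_\leq ys)$ otherwise. A sort function $\mathrm{sort}$ assigns to every type $T$ and relation $\leq$ on $T$ a function $\mathrm{sort}_\leq : \mathrm{list}\,T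 \to \mathrm{list}\,T$. It satisfies the characteristic property if there is a polymorphic function $\mathrm{asort}$ of type $\forall (T\,R : \mathcal{U}), (R \to R \to R) \to (T \to R) \to R \to \mathrm{list}\,T \to R$ such that: (1) for all $T$, $\leq$, $xs$: $\mathrm{asort}\,(\mathbin{\land\hspace{ -.45em}\land}_\leq)\,(\lambda x.[x])\,[]\,xs = \mathrm{sort}_\leq\,xs$; (2) for all $T$, $xs$: $\mathrm{asort}\,(\mathbin{+\!\!+})\,(\lambda x.[x])\,[]\,xs = xs$; (3) $\mathrm{asort}$ is relationally parametric: for all types $T_1,T_2$ and relation $\sim_T \subseteq T_1 \times T_2$, all types $R_1,R_2$ and relation $\sim_R \subseteq R_1\times R_2$, all $m_i : R_i \to R_i \to R_i$ with $a_1 \sim_R a_2 \wedge b_1 \sim_R b_2 \Rightarrow m_1\,a_1\,b_1 \sim_R m_2\,a_2\,b_2$, all $s_i : T_i \to R_i$ with $x_1 \sim_T x_2 \Rightarrow s_1\,x_1 \sim_R s_2\,x_2$, all $e_i : R_i$ with $e_1 \sim_R e_2$, and all lists $xs_1 : \mathrm{list}\,T_1$, $xs_2 : \mathrm{list}\,T_2$ of equal length that are pointwise $\sim_T$-related, we have $\mathrm{asort}\,m_1\,s_1\,e_1\,xs_1 \sim_R \mathrm{asort}\,m_2\,s_2\,e_2\,xs_2$. -}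

module Defs where

open import Data.Bool using (Bool; true; false; if_then_else_; _∧_; _∨_; not; T)
open import Data.List using (List; []; _∷_; [_]; _++_; length)
open import Data.List.Relation.Unary.Linked using (Linked)
open import Data.List.Relation.Binary.Pointwise using (Pointwise)
open import Data.Sum using (_⊎_)
open import Data.Product using (Σ; _×_)
open import Relation.Binary.PropositionalEquality using (_≡_)

Rel : Set → Set
Rel A = A → A → Bool

Total : {A : Set} → Rel A → Set
Total {A} r = ∀ (x y : A) → T (r x y) ⊎ T (r y x)

Transitive : {A : Set} → Rel A → Set
Transitive {A} r = ∀ {x y z : A} → T (r x y) → T (r y z) → T (r x z)

Sorted : {A : Set} → Rel A → List A → Set
Sorted r xs = Linked (λ x y → T (r x y)) xs

merge : {A : Set} → Rel A → List A → List A → List A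
merge r [] ys = ys
merge r (x ∷ xs) [] = x ∷ xs
merge r (x ∷ xs) (y ∷ ys) =
  if r x y then x ∷ merge r xs (y ∷ ys) else y ∷ merge r (x ∷ xs) ys

SortFun : Set₁
SortFun = ∀ {A : Set} → Rel A → List A → List A

ASort : Set₁
ASort = ∀ (A R : Set) → (R → R → R) → (A → R) → R → List A → R

Parametric : ASort → Set₁
Parametric asort =
  ∀ (A₁ A₂ : Set) (∼A : A₁ → A₂ → Set)
    (R₁ R₂ : Set) (∼R : R₁ → R₂ → Set)
    (m₁ : R₁ → R₁ → R₁) (m₂ : R₂ → R₂ → R₂) →
    (∀ {a₁ a₂ b₁ b₂} → ∼R a₁ a₂ → ∼R b₁ b₂ → ∼R (m₁ a₁ b₁) (m₂ a₂ b₂)) →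
  ∀ (s₁ : A₁ → R₁) (s₂ : A₂ → R₂) →
    (∀ {x₁ x₂} → ∼A x₁ x₂ → ∼R (s₁ x₁) (s₂ x₂)) →
  ∀ (e₁ : R₁) (e₂ : R₂) → ∼R e₁ e₂ →
  ∀ (xs₁ : List A₁) (xs₂ : List A₂) → Pointwise ∼A xs₁ xs₂ →
    ∼R (asort A₁ R₁ m₁ s₁ e₁ xs₁) (asort A₂ R₂ m₂ s₂ e₂ xs₂)

CharacteristicProperty : SortFun → Set₁
CharacteristicProperty sort =
  Σ ASort λ asort →
    (∀ (A : Set) (r : Rel A) (xs : List A) →
       asort A (List A) (merge r) [_] [] xs ≡ sort r xs)
  × (∀ (A : Set) (xs : List A) → asort A (List A) _++_ [_] [] xs ≡ xs)
  × Parametric asort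

lex : {A : Set} → Rel A → Rel A → Rel A
lex r₁ r₂ x y = r₁ x y ∧ (not (r₁ y x) ∨ r₂ x y)

-- Parametricity, applied with merge ≤₁ on one side and _++_ on the other, relates the
-- output of sort ≤₁ to the input xs (asort with _++_ is the identity) through the relation
-- "l ⊆ s, and l is lex-sorted whenever s is pairwise ≤₂-ordered". The two merges preserve
-- it because merging two lex-sorted lists, each element of the first ≤₂ each element of
-- the second, gives a lex-sorted list: when ≤₁ cannot separate the two heads, the left
-- one is taken first, and it is ≤₂ the right one. Transitivity of ≤₂ makes a ≤₂-sorted
-- list pairwise ordered.
module Submission where

open import Defs
open import Data.Bool using (true; false; T)
open import Data.Unit using (tt)
open import Data.Maybe using (just)
open import Data.Maybe.Relation.Binary.Connected using (Connected; just)
open import Data.Product using (_×_; _,_; proj₂)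
open import Data.Sum using (inj₂)
open import Data.List using (List; []; _∷_; [_]; _++_; head)
import Data.List as List
open import Data.List.Membership.Propositional using (_∈_)
open import Data.List.Relation.Unary.Any using (here; there)
open import Data.List.Relation.Unary.All using (lookup)
import Data.List.Relation.Unary.All.Properties as All
open import Data.List.Relation.Unary.AllPairs using (AllPairs; []; _∷_)
open import Data.List.Relation.Unary.Linked as Linked using ([]; [-]; _∷′_; head′)
open import Data.List.Relation.Unary.Linked.Properties using (Linked⇒AllPairs)
open import Data.List.Relation.Binary.Pointwise as Pointwise using ()
open import Data.List.Relation.Binary.Subset.Propositional using (_⊆_)
open import Data.List.Relation.Binary.Subset.Propositional.Properties
  using (⊆-refl; ⊆-trans; ⊆-reflexive-↭; ++⁺)
open import Data.List.Relation.Binary.Permutation.Propositional using (_↭_)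
import Data.List.Relation.Binary.Permutation.Propositional.Properties as ↭
open import Relation.Nullary.Decidable using (T?)
open import Relation.Binary.PropositionalEquality using (_≡_; refl; sym; cong; subst)

merge≡merge-T? : ∀ {A : Set} (r : Rel A) xs ys →
  merge r xs ys ≡ List.merge (λ x y → T? (r x y)) xs ys
merge≡merge-T? r [] ys = refl
merge≡merge-T? r (x ∷ xs) [] = refl
merge≡merge-T? r (x ∷ xs) (y ∷ ys)
  with r x y | merge≡merge-T? r xs (y ∷ ys) | merge≡merge-T? r (x ∷ xs) ys
... | true | rec | _ = cong (x ∷_) rec
... | false | _ | rec = cong (y ∷_) rec

merge-↭ : ∀ {A : Set} (r : Rel A) xs ys → merge r xs ys ↭ xs ++ ys
merge-↭ r xs ys =
  subst (_↭ xs ++ ys) (sym (merge≡merge-T? r xs ys))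
    (↭.merge-↭ (λ x y → T? (r x y)) xs ys)

module _ {A : Set} (R : A → A → Set) where

  AllAcross : List A → List A → Set
  AllAcross xs ys = ∀ {x y} → x ∈ xs → y ∈ ys → R x y

  AllPairs-++⁻ : ∀ xs {ys} → AllPairs R (xs ++ ys) →
    AllPairs R xs × AllPairs R ys × AllAcross xs ys
  AllPairs-++⁻ [] pys = [] , pys , λ ()
  AllPairs-++⁻ (x ∷ xs) (px ∷ pxsys) with AllPairs-++⁻ xs pxsys
  ... | pxs , pys , across = All.++⁻ˡ xs px ∷ pxs , pys , across′
    where
    across′ : AllAcross (x ∷ xs) _
    across′ (here refl) y∈ys = lookup (All.++⁻ʳ xs px) y∈ys
    across′ (there x∈xs) y∈ys = across x∈xs y∈ys

module _ {A : Set} (r₁ r₂ : Rel A) where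

  private
    _≤₂_ _≤lex_ : A → A → Set
    x ≤₂ y = T (r₂ x y)
    x ≤lex y = T (lex r₁ r₂ x y)

  lex-intro : ∀ {x y} → r₁ x y ≡ true → x ≤₂ y → x ≤lex y
  lex-intro {x} {y} x≤₁y x≤₂y rewrite x≤₁y with r₁ y x
  ... | true = x≤₂y
  ... | false = tt

  lex-flip : Total r₁ → ∀ {x y} → r₁ x y ≡ false → y ≤lex x
  lex-flip total {x} {y} x≰₁y with r₁ x y | total x y
  ... | false | inj₂ y≤₁x with r₁ y x
  ...   | true = tt

  module _ (total : Total r₁) where

    merge-head : ∀ {v xs ys} →
      Connected _≤lex_ (just v) (head xs) → Connected _≤lex_ (just v) (head ys) →
      Connected _≤lex_ (just v) (head (merge r₁ xs ys))
    merge-head {xs = []} v≤xs v≤ys = v≤ys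
    merge-head {xs = x ∷ xs} {[]} v≤xs v≤ys = v≤xs
    merge-head {xs = x ∷ xs} {y ∷ ys} v≤xs v≤ys with r₁ x y
    ... | true = v≤xs
    ... | false = v≤ys

    merge-sorted-lex : ∀ {xs ys} → Sorted (lex r₁ r₂) xs → Sorted (lex r₁ r₂) ys →
      AllAcross _≤₂_ xs ys → Sorted (lex r₁ r₂) (merge r₁ xs ys)
    merge-sorted-lex {[]} sxs sys across = sys
    merge-sorted-lex {x ∷ xs} {[]} sxs sys across = sxs
    merge-sorted-lex {x ∷ xs} {y ∷ ys} sxs sys across
      with r₁ x y in r₁xy≡
      | merge-sorted-lex (Linked.tail sxs) sys (λ a b → across (there a) b)
      | merge-sorted-lex sxs (Linked.tail sys) (λ a b → across a (there b))
    ... | true | rec | _ =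
      merge-head (head′ sxs) (just (lex-intro r₁xy≡ (across (here refl) (here refl))))
        ∷′ rec
    ... | false | _ | rec = merge-head (just (lex-flip total r₁xy≡)) (head′ sys) ∷′ rec

    asort-merge-sorted-lex : (asort : ASort) → Parametric asort →
      (∀ xs → asort A (List A) _++_ [_] [] xs ≡ xs) →
      ∀ xs → AllPairs _≤₂_ xs → Sorted (lex r₁ r₂) (asort A (List A) (merge r₁) [_] [] xs)
    asort-merge-sorted-lex asort parametric asort-++ xs pxs =
      proj₂ (subst (Approximates _) (asort-++ xs) approximates) pxs
      where
      Approximates : List A → List A → Set
      Approximates l s = l ⊆ s × (AllPairs _≤₂_ s → Sorted (lex r₁ r₂) l)

      merge-approximates-++ : ∀ {l₁ s₁ l₂ s₂} → Approximates l₁ s₁ → Approximates l₂ s₂ →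
        Approximates (merge r₁ l₁ l₂) (s₁ ++ s₂)
      merge-approximates-++ {l₁} {s₁} {l₂} (l₁⊆s₁ , sorted₁) (l₂⊆s₂ , sorted₂) =
        ⊆-trans (⊆-reflexive-↭ (merge-↭ r₁ l₁ l₂)) (++⁺ l₁⊆s₁ l₂⊆s₂) ,
        λ ps → let ps₁ , ps₂ , across = AllPairs-++⁻ _≤₂_ s₁ ps in
          merge-sorted-lex (sorted₁ ps₁) (sorted₂ ps₂) (λ a b → across (l₁⊆s₁ a) (l₂⊆s₂ b))

      singleton-approximates : ∀ {x y} → x ≡ y → Approximates [ x ] [ y ]
      singleton-approximates refl = ⊆-refl , λ _ → [-]

      approximates : Approximates (asort A (List A) (merge r₁) [_] [] xs)
                                  (asort A (List A) _++_ [_] [] xs)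
      approximates = parametric A A _≡_ (List A) (List A) Approximates
        (merge r₁) _++_ merge-approximates-++ [_] [_] singleton-approximates
        [] [] (⊆-refl , λ _ → []) xs xs (Pointwise.refl refl)

corollary3p12 : (sort : SortFun) → CharacteristicProperty sort →
    ∀ (A : Set) (r₁ r₂ : Rel A) → Total r₁ → Transitive r₂ →
    (xs : List A) → Sorted r₂ xs → Sorted (lex r₁ r₂) (sort r₁ xs)
corollary3p12 sort (asort , asort-merge , asort-++ , parametric) A r₁ r₂ total transitive xs sorted =
  subst (Sorted (lex r₁ r₂)) (asort-merge A r₁ xs)
    (asort-merge-sorted-lex r₁ r₂ total asort parametric (asort-++ A) xs
      (Linked⇒AllPairs transitive sorted))
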